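{- Let $\lambda,\mu$ be integer partitions with $\lambda_i\ge\mu_i$ for all $i$, and let $\mathbf{w},\mathbf{w}'$ be integer compositions with $\mathbf{w}'<_{\mathrm{ref}}\mathbf{w}$. Let $P=\mathcal{P}_{\lambda/\mu,\mathbf{w}}\subset\mathbb{R}^d$ and $P'=\mathcal{P}_{\lambda/\mu,\mathbf{w}'}\subset\mathbb{R}^{d'}$. Then: (1) $|P'\cap\mathbb{Z}^{d'}|\ge|P\cap\mathbb{Z}^d|$; (2) if $P'$ is empty then $P$ is empty; (3) if $P'$ is integral then $P$ is integral; (4) if $P'$ has the integer decomposition property then so does $P$.
   Context: An integer composition is a finite sequence of positive integers. $\mathbf{w}'\le_{\mathrm{ref}}\mathbf{w}$ means $\mathbf{w}'$ is a refinement of $\mathbf{w}$, i.e. $\mathbf{w}$ is obtained from $\mathbf{w}'$ by adding together consecutive blocks of parts; $<_{\mathrm{ref}}$ is the strict version. For a composition $\mathbf{w}=(w_1,\dots,w_{m-1})$, a Gelfand--Tsetlin (GT) pattern is a real array $(x^i_j)_{1\le i\le m,\,1\le j\le n}$ ($n$ at least the length of $\lambda$, partitions padded with zeros) with $x^{i+1}_j\ge x^i_j$ and $x^i_j\ge x^{i+1}_{j+1}$ whenever defined; $\mathcal{P}_{\lambda/\mu,\mathbf{w}}\subset\mathbb{R}^{mn}$ is the polytope of GT patterns with $\mathbf{x}^m=\lambda$, $\mathbf{x}^1=\mu$, and $\sum_jx^{i+1}_j-\sum_jx^i_j=w_i$ for $i=1,\dots,m-1$. A polytope is integral if all its vertices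 are lattice points. An integral polytope $Q\subset\mathbb{R}^d$ has the integer decomposition property (IDP) if for every positive integer $k$ and every $\mathbf{x}\in kQ\cap\mathbb{Z}^d$ there are $\mathbf{x}^1,\dots,\mathbf{x}^k\in Q\cap\mathbb{Z}^d$ with $\mathbf{x}^1+\dots+\mathbf{x}^k=\mathbf{x}$. Note $k\mathcal{P}_{\lambda/\mu,\mathbf{w}}=\mathcal{P}_{k\lambda/k\mu,k\mathbf{w}}$.
   Formalization: Points of P and P′ have rational coordinates, lying in ℚ^d and ℚ^d′ instead of $\mathbb{R}^d$ and $\mathbb{R}^{d'}$. -}

module Defs where

open import Data.Nat as ℕ using (ℕ; zero; suc)
open import Data.Integer as ℤ using (ℤ)
open import Data.Rational as ℚ using (ℚ; 0ℚ; 1ℚ)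
open import Data.Fin using (Fin; toℕ; inject₁; fromℕ)
import Data.Fin as F
open import Data.Vec as V using (Vec; lookup)
open import Data.Vec.Relation.Unary.All as VAll using ()
open import Data.List as L using (List; length)
open import Data.List.Relation.Unary.All as LAll using ()
open import Data.Nat.ListAction using (sum)
open import Data.Product using (Σ; ∃; _×_; _,_)
open import Relation.Binary.PropositionalEquality using (_≡_; _≢_)
open import Relation.Nullary using (¬_)

-- A partition padded to length n: a weakly decreasing vector of naturals.
IsPartition : ∀ {n} → Vec ℕ n → Set
IsPartition {n} v = ∀ (j k : Fin n) → toℕ k ≡ suc (toℕ j) → lookup v k ℕ.≤ lookup v j

IsComposition : List ℕ → Set
IsComposition w = LAll.All (λ a → 0 ℕ.< a) w

_≤ref_ : List ℕ → List ℕ → Set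
w' ≤ref w = Σ (List (List ℕ)) λ blocks →
  LAll.All (λ b → b ≢ L.[]) blocks × (L.concat blocks ≡ w') × (L.map sum blocks ≡ w)

_<ref_ : List ℕ → List ℕ → Set
w' <ref w = (w' ≤ref w) × (w' ≢ w)

-- Points: m × n arrays (x^i_j), rows i (1..m) indexed by Fin m, columns j by Fin n.
-- Real coordinates are replaced by rational ones.

Pat : ℕ → ℕ → Set
Pat m n = Vec (Vec ℚ n) m

ZPat : ℕ → ℕ → Set
ZPat m n = Vec (Vec ℤ n) m

entry : ∀ {m n} → Pat m n → Fin m → Fin n → ℚ
entry x i j = lookup (lookup x i) j

toPat : ∀ {m n} → ZPat m n → Pat m n
toPat = V.map (V.map (λ z → z ℚ./ 1))

ℕtoℚ : ℕ → ℚ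
ℕtoℚ a = ℤ.+ a ℚ./ 1

rowSum : ∀ {n} → Vec ℚ n → ℚ
rowSum = V.foldr _ ℚ._+_ 0ℚ

Region : ℕ → ℕ → Set₁
Region m n = Pat m n → Set

-- The Gelfand–Tsetlin polytope P_{λ/μ,w}, with m = length w + 1 rows.
-- Row (inject₁ i) is x^{i+1} and row (suc i) is x^{i+2} (0-based i),
-- row zero is x^1 and row (fromℕ (length w)) is x^m.

GT : ∀ {n} → Vec ℕ n → Vec ℕ n → (w : List ℕ) → Region (suc (length w)) n
GT {n} la mu w x =
  (∀ (i : Fin (length w)) (j : Fin n) →
      entry x (inject₁ i) j ℚ.≤ entry x (F.suc i) j)
  × (∀ (i : Fin (length w)) (j k : Fin n) → toℕ k ≡ suc (toℕ j) →
      entry x (F.suc i) k ℚ.≤ entry x (inject₁ i) j)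
  × (lookup x (fromℕ (length w)) ≡ V.map ℕtoℚ la)
  × (lookup x F.zero ≡ V.map ℕtoℚ mu)
  × (∀ (i : Fin (length w)) →
      rowSum (lookup x (F.suc i)) ℚ.- rowSum (lookup x (inject₁ i))
        ≡ ℕtoℚ (L.lookup w i))

_⊕_ : ∀ {m n} → Pat m n → Pat m n → Pat m n
x ⊕ y = V.zipWith (V.zipWith ℚ._+_) x y

_•_ : ∀ {m n} → ℚ → Pat m n → Pat m n
t • x = V.map (V.map (t ℚ.*_)) x

-- |P ∩ ℤ^d| ≤ |Q ∩ ℤ^d'| : an injection of lattice points of P into those of Q
LatticeCardLeq : ∀ {m m' n} → Region m n → Region m' n → Set
LatticeCardLeq {m} {m'} {n} P Q =
  Σ (ZPat m n → ZPat m' n) λ f →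
    (∀ z → P (toPat z) → Q (toPat (f z)))
    × (∀ z z' → P (toPat z) → P (toPat z') → f z ≡ f z' → z ≡ z')

IsEmpty : ∀ {m n} → Region m n → Set
IsEmpty P = ∀ x → ¬ P x

-- vertex = extreme point: not in the open segment between two distinct points of P
IsVertex : ∀ {m n} → Region m n → Pat m n → Set
IsVertex P x = P x × (∀ y z t → P y → P z → 0ℚ ℚ.< t → t ℚ.< 1ℚ →
                       x ≡ (t • y) ⊕ ((1ℚ ℚ.- t) • z) → y ≡ z)

IsLatticePoint : ∀ {m n} → Pat m n → Set
IsLatticePoint {m} {n} x = ∃ λ (z : ZPat m n) → x ≡ toPat z

Integral : ∀ {m n} → Region m n → Set
Integral P = ∀ x → IsVertex P x → IsLatticePoint x

Dilate : ∀ {m n} → ℕ → Region m n → Region m n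
Dilate k P x = ∃ λ y → P y × (x ≡ ℕtoℚ k • y)

zsum : ∀ {m n k} → Vec (ZPat m n) k → ZPat m n
zsum = V.foldr _ (V.zipWith (V.zipWith ℤ._+_)) (V.replicate _ (V.replicate _ (ℤ.+ 0)))

HasIDP : ∀ {m n} → Region m n → Set
HasIDP {m} {n} P =
  Integral P
  × (∀ (k : ℕ) → 1 ℕ.≤ k → ∀ (z : ZPat m n) → Dilate k P (toPat z) →
       ∃ λ (zs : Vec (ZPat m n) k) →
         VAll.All (λ u → P (toPat u)) zs × (zsum zs ≡ z))

{-# OPTIONS --safe #-}
-- Each refinement is a sequence of splittings of one part a + b into a, b, and the four
-- conclusions compose, so it suffices to split a single part.  Between the rows r ≺ t of
-- a pattern whose sums differ by a + b, insert the row obtained by raising r towards t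
-- greedily from the last column until a has been spent.  That row agrees with r before
-- some column c and with t after it, so the lift lands on a face of P' (a face of the
-- cone r ≤ y ≤ t containing P'), on which deleting the row is injective because the row
-- sum fixes the free entry.  The lift commutes with ℤ ⊂ ℚ and with dilation; hence it
-- maps lattice points of P injectively into P', vertices of P to vertices of P', and the
-- summands of an integer decomposition of a lifted point, which all lie on the face,
-- delete to an integer decomposition in P.
module Submission where

open import Defs
open import Data.Nat as ℕ using (ℕ; zero; suc; _≤_)
import Data.Nat.Properties as ℕP
import Data.Nat.Coprimality as Coprime
open import Data.Integer as ℤ using (ℤ; +_; -[1+_])
import Data.Integer.Properties as ℤP
open import Data.Rational as ℚ using (ℚ; 0ℚ; 1ℚ; mkℚ; _/_)
import Data.Rational.Properties as ℚP
open import Data.Rational.Solver using (module +-*-Solver)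
open import Algebra.Properties.Group ℚP.+-0-group
  using (∙-cancelˡ; ∙-cancelʳ) renaming (⁻¹-involutive to neg-involutive)
open import Data.Fin as F using (Fin; toℕ; inject₁; fromℕ)
open import Data.Vec as V using (Vec; []; _∷_; lookup)
import Data.Vec.Properties as VP
open import Data.Vec.Relation.Binary.Pointwise.Inductive as Pointwise using (Pointwise; []; _∷_)
open import Data.Vec.Relation.Unary.All as VAll using ([]; _∷_)
import Data.Vec.Relation.Unary.All.Properties as AllP
open import Data.List as L using (List; []; _∷_; _++_; length)
import Data.List.Relation.Unary.All as LAll
open import Data.Nat.ListAction using (sum)
open import Data.Product as Prod using (∃; ∃-syntax; _×_; _,_; proj₁; proj₂)
open import Data.Sum using (_⊎_; inj₁; inj₂)
open import Data.Unit using (⊤; tt)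
open import Data.Empty using (⊥-elim)
open import Relation.Binary.PropositionalEquality
open import Function using (_∘_)
open import Relation.Binary.Construct.Closure.ReflexiveTransitive as Star using (Star; ε; _◅_; _◅◅_)
open +-*-Solver

ι : ℤ → ℚ
ι z = z / 1

ι≡mkℚ : ∀ z → ι z ≡ mkℚ z 0 (Coprime.sym (Coprime.1-coprimeTo ℤ.∣ z ∣))
ι≡mkℚ (+ n)    = ℚP.normalize-coprime _
ι≡mkℚ -[1+ n ] = cong ℚ.-_ (ℚP.normalize-coprime (Coprime.sym (Coprime.1-coprimeTo (suc n))))

ι-homo-+ : ∀ a b → ι (a ℤ.+ b) ≡ ι a ℚ.+ ι b
ι-homo-+ a b rewrite ι≡mkℚ a | ι≡mkℚ b =
  cong (_/ 1) (sym (cong₂ ℤ._+_ (ℤP.*-identityʳ a) (ℤP.*-identityʳ b)))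

ι-homo-neg : ∀ z → ι (ℤ.- z) ≡ ℚ.- ι z
ι-homo-neg (+ zero)  = refl
ι-homo-neg (+ suc n) = refl
ι-homo-neg -[1+ n ]  = sym (neg-involutive _)

ι-homo-- : ∀ a b → ι (a ℤ.- b) ≡ ι a ℚ.- ι b
ι-homo-- a b = trans (ι-homo-+ a (ℤ.- b)) (cong (ι a ℚ.+_) (ι-homo-neg b))

ι-mono-≤ : ∀ {a b} → a ℤ.≤ b → ι a ℚ.≤ ι b
ι-mono-≤ {a} {b} a≤b rewrite ι≡mkℚ a | ι≡mkℚ b =
  ℚ.*≤* (subst₂ ℤ._≤_ (sym (ℤP.*-identityʳ a)) (sym (ℤP.*-identityʳ b)) a≤b)

ι-homo-⊓ : ∀ a b → ι (a ℤ.⊓ b) ≡ ι a ℚ.⊓ ι b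
ι-homo-⊓ a b with ℤP.≤-total a b
... | inj₁ a≤b = trans (cong ι (ℤP.i≤j⇒i⊓j≡i a≤b)) (sym (ℚP.p≤q⇒p⊓q≡p (ι-mono-≤ a≤b)))
... | inj₂ b≤a = trans (cong ι (ℤP.i≥j⇒i⊓j≡j b≤a)) (sym (ℚP.p≥q⇒p⊓q≡q (ι-mono-≤ b≤a)))

ℕtoℚ-homo-+ : ∀ a b → ℕtoℚ (a ℕ.+ b) ≡ ℕtoℚ a ℚ.+ ℕtoℚ b
ℕtoℚ-homo-+ a b = ι-homo-+ (+ a) (+ b)

ℕtoℚ-homo-* : ∀ a b → ℕtoℚ (a ℕ.* b) ≡ ℕtoℚ a ℚ.* ℕtoℚ b
ℕtoℚ-homo-* a b =
  trans (cong ι (ℤP.pos-* a b)) (sym (cong₂ ℚ._*_ (ι≡mkℚ (+ a)) (ι≡mkℚ (+ b))))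

0≤ℕtoℚ : ∀ a → 0ℚ ℚ.≤ ℕtoℚ a
0≤ℕtoℚ a = ι-mono-≤ {+ 0} {+ a} (ℤ.+≤+ ℕ.z≤n)

p≤q⇒0≤q-p : ∀ {p q} → p ℚ.≤ q → 0ℚ ℚ.≤ q ℚ.- p
p≤q⇒0≤q-p {p} {q} p≤q = subst (ℚ._≤ q ℚ.- p) (ℚP.+-inverseʳ p) (ℚP.+-monoˡ-≤ (ℚ.- p) p≤q)

p<q⇒0<q-p : ∀ {p q} → p ℚ.< q → 0ℚ ℚ.< q ℚ.- p
p<q⇒0<q-p {p} {q} p<q = subst (ℚ._< q ℚ.- p) (ℚP.+-inverseʳ p) (ℚP.+-monoˡ-< (ℚ.- p) p<q)

+-tight : ∀ {p q p' q'} → p ℚ.≤ p' → q ℚ.≤ q' → p ℚ.+ q ≡ p' ℚ.+ q' → p ≡ p' × q ≡ q'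
+-tight p≤p' q≤q' eq =
  ℚP.≤-antisym p≤p' (ℚP.≮⇒≥ λ p<p' → ℚP.<-irrefl eq (ℚP.+-mono-<-≤ p<p' q≤q')) ,
  ℚP.≤-antisym q≤q' (ℚP.≮⇒≥ λ q<q' → ℚP.<-irrefl eq (ℚP.+-mono-≤-< p≤p' q<q'))

*-cancelˡ-≡-pos : ∀ {s p q} → 0ℚ ℚ.< s → s ℚ.* p ≡ s ℚ.* q → p ≡ q
*-cancelˡ-≡-pos {s} 0<s eq =
  ℚP.≤-antisym (cancel (ℚP.≤-reflexive eq)) (cancel (ℚP.≤-reflexive (sym eq)))
  where
  cancel : ∀ {p q} → s ℚ.* p ℚ.≤ s ℚ.* q → p ℚ.≤ q
  cancel = ℚP.*-cancelˡ-≤-pos s {{ℚ.positive 0<s}}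

Row : ℕ → Set
Row n = Vec ℚ n

infix 4 _≤ᵣ_ _≺_
infixl 6 _+ᵣ_
infixl 7 _*ᵣ_

_≤ᵣ_ : ∀ {n} → Row n → Row n → Set
_≤ᵣ_ = Pointwise ℚ._≤_

_+ᵣ_ : ∀ {n} → Row n → Row n → Row n
_+ᵣ_ = V.zipWith ℚ._+_

_*ᵣ_ : ∀ {n} → ℚ → Row n → Row n
s *ᵣ r = V.map (s ℚ.*_) r

≤ᵣ-refl : ∀ {n} {r : Row n} → r ≤ᵣ r
≤ᵣ-refl = Pointwise.refl ℚP.≤-refl

+ᵣ-mono-≤ᵣ : ∀ {n} {r s r' s' : Row n} → r ≤ᵣ s → r' ≤ᵣ s' → r +ᵣ r' ≤ᵣ s +ᵣ s'
+ᵣ-mono-≤ᵣ = Pointwise.zipWith-cong ℚP.+-mono-≤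

*ᵣ-mono-≤ᵣ : ∀ {n} {s} {r r' : Row n} → 0ℚ ℚ.≤ s → r ≤ᵣ r' → s *ᵣ r ≤ᵣ s *ᵣ r'
*ᵣ-mono-≤ᵣ {s = s} 0≤s = Pointwise.map⁺ (ℚP.*-monoˡ-≤-nonNeg s {{ℚ.nonNegative 0≤s}})

+ᵣ-tight : ∀ {n} {r s r' s' : Row n} → r ≤ᵣ r' → s ≤ᵣ s' → r +ᵣ s ≡ r' +ᵣ s' →
           r ≡ r' × s ≡ s'
+ᵣ-tight [] [] _ = refl , refl
+ᵣ-tight (p≤p' ∷ r≤r') (q≤q' ∷ s≤s') eq =
  let p≡p' , q≡q' = +-tight p≤p' q≤q' (VP.∷-injectiveˡ eq)
      r≡r' , s≡s' = +ᵣ-tight r≤r' s≤s' (VP.∷-injectiveʳ eq)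
  in cong₂ _∷_ p≡p' r≡r' , cong₂ _∷_ q≡q' s≡s'

*ᵣ-cancelˡ-pos : ∀ {n} {s} {r r' : Row n} → 0ℚ ℚ.< s → s *ᵣ r ≡ s *ᵣ r' → r ≡ r'
*ᵣ-cancelˡ-pos {r = []}    {[]}     _   _  = refl
*ᵣ-cancelˡ-pos {r = _ ∷ _} {_ ∷ _} 0<s eq =
  cong₂ _∷_ (*-cancelˡ-≡-pos 0<s (VP.∷-injectiveˡ eq)) (*ᵣ-cancelˡ-pos 0<s (VP.∷-injectiveʳ eq))

HeadAtMost : ∀ {n} → Row n → ℚ → Set
HeadAtMost []      _ = ⊤
HeadAtMost (s ∷ _) r = s ℚ.≤ r

data _≺_ : ∀ {n} → Row n → Row n → Set where
  []        : [] ≺ []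
  interlace : ∀ {n r s} {rs ss : Row n} →
              r ℚ.≤ s → HeadAtMost ss r → rs ≺ ss → r ∷ rs ≺ s ∷ ss

≺⇒≤ᵣ : ∀ {n} {r s : Row n} → r ≺ s → r ≤ᵣ s
≺⇒≤ᵣ []                   = []
≺⇒≤ᵣ (interlace r≤s _ rs≺ss) = r≤s ∷ ≺⇒≤ᵣ rs≺ss

HeadAtMost-monoˡ : ∀ {n} {s s' : Row n} {r} → s' ≤ᵣ s → HeadAtMost s r → HeadAtMost s' r
HeadAtMost-monoˡ []           _ = tt
HeadAtMost-monoˡ (s'≤s ∷ _) s≤r = ℚP.≤-trans s'≤s s≤r

HeadAtMost-monoʳ : ∀ {n} {s : Row n} {r r'} → r ℚ.≤ r' → HeadAtMost s r → HeadAtMost s r'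
HeadAtMost-monoʳ {s = []}    _    _   = tt
HeadAtMost-monoʳ {s = _ ∷ _} r≤r' s≤r = ℚP.≤-trans s≤r r≤r'

≺-sandwich : ∀ {n} {r y t : Row n} → r ≺ t → r ≤ᵣ y → y ≤ᵣ t → r ≺ y × y ≺ t
≺-sandwich [] [] [] = [] , []
≺-sandwich (interlace _ hd rs≺ts) (r≤y ∷ rs≤ys) (y≤t ∷ ys≤ts) =
  let rs≺ys , ys≺ts = ≺-sandwich rs≺ts rs≤ys ys≤ts
  in interlace r≤y (HeadAtMost-monoˡ ys≤ts hd) rs≺ys , interlace y≤t (HeadAtMost-monoʳ r≤y hd) ys≺ts

data Spliced : ∀ {n} → ℕ → Row n → Row n → Row n → Set where
  []    : ∀ {c} → Spliced c [] [] []
  here  : ∀ {n r y t} {rs ys ts : Row n} → ys ≡ ts → Spliced zero (r ∷ rs) (y ∷ ys) (t ∷ ts)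
  there : ∀ {n c r y t} {rs ys ts : Row n} →
          y ≡ r → Spliced c rs ys ts → Spliced (suc c) (r ∷ rs) (y ∷ ys) (t ∷ ts)

≺-merge : ∀ {n c} {r y t : Row n} → Spliced c r y t → r ≺ y → y ≺ t → r ≺ t
≺-merge []               []                       []                      = []
≺-merge (here refl)      (interlace r≤y hd rs≺ys) (interlace y≤t _ _)     =
  interlace (ℚP.≤-trans r≤y y≤t) hd rs≺ys
≺-merge (there refl sp)  (interlace _ _ rs≺ys)   (interlace y≤t hd ys≺ts) =
  interlace y≤t hd (≺-merge sp rs≺ys ys≺ts)

Spliced-unique : ∀ {n c} {r y y' t : Row n} →
                 Spliced c r y t → Spliced c r y' t → rowSum y ≡ rowSum y' → y ≡ y'
Spliced-unique []                [] _ = refl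
Spliced-unique (here refl)       (here refl) eq = cong (_∷ _) (∙-cancelʳ _ _ _ eq)
Spliced-unique {r = r ∷ _} (there refl sp) (there refl sp') eq =
  cong (r ∷_) (Spliced-unique sp sp' (∙-cancelˡ r _ _ eq))

Spliced-+ᵣ⁻ : ∀ {n c} {r y t r' y' t' : Row n} →
              r ≤ᵣ y → y ≤ᵣ t → r' ≤ᵣ y' → y' ≤ᵣ t' →
              Spliced c (r +ᵣ r') (y +ᵣ y') (t +ᵣ t') → Spliced c r y t × Spliced c r' y' t'
Spliced-+ᵣ⁻ [] [] [] [] [] = [] , []
Spliced-+ᵣ⁻ (_ ∷ _) (_ ∷ ys≤ts) (_ ∷ _) (_ ∷ ys'≤ts') (here eq) =
  let e , e' = +ᵣ-tight ys≤ts ys'≤ts' eq in here e , here e'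
Spliced-+ᵣ⁻ (r≤y ∷ rs≤ys) (_ ∷ ys≤ts) (r'≤y' ∷ rs'≤ys') (_ ∷ ys'≤ts') (there eq sp) =
  let e , e' = +-tight r≤y r'≤y' (sym eq)
      sp₁ , sp₂ = Spliced-+ᵣ⁻ rs≤ys ys≤ts rs'≤ys' ys'≤ts' sp
  in there (sym e) sp₁ , there (sym e') sp₂

Spliced-*ᵣ⁻ : ∀ {n c s} {r y t : Row n} → 0ℚ ℚ.< s →
              Spliced c (s *ᵣ r) (s *ᵣ y) (s *ᵣ t) → Spliced c r y t
Spliced-*ᵣ⁻ {r = []}    {[]}    {[]}    _   []            = []
Spliced-*ᵣ⁻ {r = _ ∷ _} {_ ∷ _} {_ ∷ _} 0<s (here eq)     = here (*ᵣ-cancelˡ-pos 0<s eq)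
Spliced-*ᵣ⁻ {r = _ ∷ _} {_ ∷ _} {_ ∷ _} 0<s (there eq sp) =
  there (*-cancelˡ-≡-pos 0<s eq) (Spliced-*ᵣ⁻ 0<s sp)

Spliced-map : ∀ {n c} (h : ℚ → ℚ) {r y t : Row n} →
              Spliced c r y t → Spliced c (V.map h r) (V.map h y) (V.map h t)
Spliced-map h []            = []
Spliced-map h (here eq)     = here (cong (V.map h) eq)
Spliced-map h (there eq sp) = there (cong h eq) (Spliced-map h sp)

-- Generic in the carrier, so that the same filling runs over ℤ and commutes with dilation (fill-map).
module Fill {A : Set} (_+_ _-_ _⊓_ : A → A → A) where

  push : ∀ {n} → A → A → Vec A n × A → Vec A (suc n) × A
  push r t (ys , a) = r + ((t - r) ⊓ a) ∷ ys , a - ((t - r) ⊓ a)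

  fill : ∀ {n} → A → Vec A n → Vec A n → Vec A n × A
  fill a []       []       = [] , a
  fill a (r ∷ rs) (t ∷ ts) = push r t (fill a rs ts)

module _ {A B : Set} {_+ᴬ_ _-ᴬ_ _⊓ᴬ_ : A → A → A} {_+ᴮ_ _-ᴮ_ _⊓ᴮ_ : B → B → B} (h : A → B)
         (h-+ : ∀ x y → h (x +ᴬ y) ≡ h x +ᴮ h y)
         (h-- : ∀ x y → h (x -ᴬ y) ≡ h x -ᴮ h y)
         (h-⊓ : ∀ x y → h (x ⊓ᴬ y) ≡ h x ⊓ᴮ h y) where

  private
    module Aᶠ = Fill _+ᴬ_ _-ᴬ_ _⊓ᴬ_
    module Bᶠ = Fill _+ᴮ_ _-ᴮ_ _⊓ᴮ_

  push-map : ∀ {n} r t (p : Vec A n × A) →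
             Bᶠ.push (h r) (h t) (Prod.map (V.map h) h p) ≡ Prod.map (V.map h) h (Aᶠ.push r t p)
  push-map r t (ys , a) = cong₂ _,_
    (cong (_∷ V.map h ys) (sym (trans (h-+ r δ) (cong (h r +ᴮ_) hδ))))
    (sym (trans (h-- a δ) (cong (h a -ᴮ_) hδ)))
    where
    δ = (t -ᴬ r) ⊓ᴬ a
    hδ : h δ ≡ (h t -ᴮ h r) ⊓ᴮ h a
    hδ = trans (h-⊓ (t -ᴬ r) a) (cong (_⊓ᴮ h a) (h-- t r))

  fill-map : ∀ {n} a (r t : Vec A n) →
             Bᶠ.fill (h a) (V.map h r) (V.map h t) ≡ Prod.map (V.map h) h (Aᶠ.fill a r t)
  fill-map a []       []       = refl
  fill-map a (r ∷ rs) (t ∷ ts) =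
    trans (cong (Bᶠ.push (h r) (h t)) (fill-map a rs ts)) (push-map r t (Aᶠ.fill a rs ts))

open Fill ℚ._+_ ℚ._-_ ℚ._⊓_ using (push; fill)
module ℤFill = Fill ℤ._+_ ℤ._-_ ℤ._⊓_

ι-fill : ∀ {n} a (r t : Vec ℤ n) →
         fill (ι a) (V.map ι r) (V.map ι t) ≡ Prod.map (V.map ι) ι (ℤFill.fill a r t)
ι-fill = fill-map ι ι-homo-+ ι-homo-- ι-homo-⊓

*-fill : ∀ {n} s → 0ℚ ℚ.≤ s → ∀ a (r t : Row n) →
         fill (s ℚ.* a) (s *ᵣ r) (s *ᵣ t) ≡ Prod.map (s *ᵣ_) (s ℚ.*_) (fill a r t)
*-fill s 0≤s =
  fill-map (s ℚ.*_) (ℚP.*-distribˡ-+ s) *-distribˡ-- (ℚP.*-distribˡ-⊓-nonNeg s {{ℚ.nonNegative 0≤s}})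
  where
  *-distribˡ-- : ∀ x y → s ℚ.* (x ℚ.- y) ≡ s ℚ.* x ℚ.- s ℚ.* y
  *-distribˡ-- = solve 3 (λ s x y → s :* (x :- y) := s :* x :- s :* y) refl s

fill-conserves : ∀ {n} a (r t : Row n) →
                 rowSum (proj₁ (fill a r t)) ℚ.+ proj₂ (fill a r t) ≡ rowSum r ℚ.+ a
fill-conserves a []       []       = refl
fill-conserves a (r ∷ rs) (t ∷ ts) = begin
  (r ℚ.+ δ) ℚ.+ rowSum ys ℚ.+ (a' ℚ.- δ) ≡⟨ solve 4 (λ r δ s a' → (r :+ δ) :+ s :+ (a' :- δ) := r :+ (s :+ a'))
                                                     refl r δ (rowSum ys) a' ⟩
  r ℚ.+ (rowSum ys ℚ.+ a')              ≡⟨ cong (r ℚ.+_) (fill-conserves a rs ts) ⟩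
  r ℚ.+ (rowSum rs ℚ.+ a)               ≡⟨ ℚP.+-assoc r (rowSum rs) a ⟨
  r ℚ.+ rowSum rs ℚ.+ a                 ∎
  where
  open ≡-Reasoning
  ys = proj₁ (fill a rs ts)
  a' = proj₂ (fill a rs ts)
  δ = (t ℚ.- r) ℚ.⊓ a'

fill-bounds : ∀ {n a} {r t : Row n} → r ≤ᵣ t → 0ℚ ℚ.≤ a →
              r ≤ᵣ proj₁ (fill a r t) × proj₁ (fill a r t) ≤ᵣ t × 0ℚ ℚ.≤ proj₂ (fill a r t)
fill-bounds []                  0≤a = [] , [] , 0≤a
fill-bounds {a = a} {r ∷ rs} {t ∷ ts} (r≤t ∷ rs≤ts) 0≤a =
  r≤r+δ ∷ rs≤ys , r+δ≤t ∷ ys≤ts , p≤q⇒0≤q-p (ℚP.p⊓q≤q (t ℚ.- r) a')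
  where
  a' = proj₂ (fill a rs ts)
  δ = (t ℚ.- r) ℚ.⊓ a'
  ih = fill-bounds rs≤ts 0≤a
  rs≤ys = proj₁ ih
  ys≤ts = proj₁ (proj₂ ih)
  0≤δ : 0ℚ ℚ.≤ δ
  0≤δ = ℚP.⊓-glb (p≤q⇒0≤q-p r≤t) (proj₂ (proj₂ ih))
  r≤r+δ : r ℚ.≤ r ℚ.+ δ
  r≤r+δ = subst (ℚ._≤ r ℚ.+ δ) (ℚP.+-identityʳ r) (ℚP.+-monoʳ-≤ r 0≤δ)
  r+δ≤t : r ℚ.+ δ ℚ.≤ t
  r+δ≤t = subst (r ℚ.+ δ ℚ.≤_) (solve 2 (λ r t → r :+ (t :- r) := t) refl r t)
                (ℚP.+-monoʳ-≤ r (ℚP.p⊓q≤p (t ℚ.- r) a'))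

p≤q⇒[q-p]⊓0≡0 : ∀ {p q} → p ℚ.≤ q → (q ℚ.- p) ℚ.⊓ 0ℚ ≡ 0ℚ
p≤q⇒[q-p]⊓0≡0 p≤q = ℚP.p≥q⇒p⊓q≡q (p≤q⇒0≤q-p p≤q)

push-saturates : ∀ {n r t a} {ys ts : Row n} → r ℚ.≤ t → a ≡ 0ℚ ⊎ ys ≡ ts →
                 proj₂ (push r t (ys , a)) ≡ 0ℚ ⊎ proj₁ (push r t (ys , a)) ≡ t ∷ ts
push-saturates r≤t (inj₁ refl) = inj₁ (cong (λ δ → 0ℚ ℚ.- δ) (p≤q⇒[q-p]⊓0≡0 r≤t))
push-saturates {r = r} {t} {a} r≤t (inj₂ refl) with ℚP.≤-total (t ℚ.- r) a
... | inj₁ t-r≤a = inj₂ (cong (_∷ _) (trans (cong (r ℚ.+_) (ℚP.p≤q⇒p⊓q≡p t-r≤a))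
                                            (solve 2 (λ r t → r :+ (t :- r) := t) refl r t)))
... | inj₂ a≤t-r = inj₁ (trans (cong (λ δ → a ℚ.- δ) (ℚP.p≥q⇒p⊓q≡q a≤t-r)) (ℚP.+-inverseʳ a))

fill-saturates : ∀ {n a} {r t : Row n} → r ≤ᵣ t → proj₂ (fill a r t) ≡ 0ℚ ⊎ proj₁ (fill a r t) ≡ t
fill-saturates []            = inj₂ refl
fill-saturates (r≤t ∷ rs≤ts) = push-saturates r≤t (fill-saturates rs≤ts)

push-spliced : ∀ {n c r t a} {rs ys ts : Row n} → r ℚ.≤ t → a ≡ 0ℚ ⊎ ys ≡ ts → Spliced c rs ys ts →
               ∃[ c' ] Spliced c' (r ∷ rs) (proj₁ (push r t (ys , a))) (t ∷ ts)
push-spliced {c = c} {r} r≤t (inj₁ refl) sp =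
  suc c , there (trans (cong (r ℚ.+_) (p≤q⇒[q-p]⊓0≡0 r≤t)) (ℚP.+-identityʳ r)) sp
push-spliced r≤t (inj₂ refl) _ = zero , here refl

fill-spliced : ∀ {n a} {r t : Row n} → r ≤ᵣ t → ∃[ c ] Spliced c r (proj₁ (fill a r t)) t
fill-spliced []            = zero , []
fill-spliced (r≤t ∷ rs≤ts) = push-spliced r≤t (fill-saturates rs≤ts) (proj₂ (fill-spliced rs≤ts))

Step : ∀ {n} → ℕ → Row n → Row n → Set
Step a r s = r ≺ s × rowSum s ≡ rowSum r ℚ.+ ℕtoℚ a

fillRow : ∀ {n} → ℕ → Row n → Row n → Row n
fillRow a r t = proj₁ (fill (ℕtoℚ a) r t)

fill-exhausts : ∀ {n} a b {r t : Row n} → Step (a ℕ.+ b) r t → proj₂ (fill (ℕtoℚ a) r t) ≡ 0ℚ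
fill-exhausts a b {r} {t} (r≺t , Σt) with fill-saturates {a = ℕtoℚ a} (≺⇒≤ᵣ r≺t)
... | inj₁ spent = spent
... | inj₂ y≡t   = ℚP.≤-antisym lo≤0 (proj₂ (proj₂ (fill-bounds (≺⇒≤ᵣ r≺t) (0≤ℕtoℚ a))))
  where
  open ≡-Reasoning
  lo = proj₂ (fill (ℕtoℚ a) r t)
  B+lo≡0 : ℕtoℚ b ℚ.+ lo ≡ 0ℚ
  B+lo≡0 = ∙-cancelˡ (rowSum r ℚ.+ ℕtoℚ a) _ _ (begin
    rowSum r ℚ.+ ℕtoℚ a ℚ.+ (ℕtoℚ b ℚ.+ lo)   ≡⟨ solve 4 (λ R A B l → R :+ A :+ (B :+ l) := R :+ (A :+ B) :+ l)
                                                        refl (rowSum r) (ℕtoℚ a) (ℕtoℚ b) lo ⟩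
    rowSum r ℚ.+ (ℕtoℚ a ℚ.+ ℕtoℚ b) ℚ.+ lo   ≡⟨ cong (λ s → rowSum r ℚ.+ s ℚ.+ lo) (ℕtoℚ-homo-+ a b) ⟨
    rowSum r ℚ.+ ℕtoℚ (a ℕ.+ b) ℚ.+ lo        ≡⟨ cong (ℚ._+ lo) Σt ⟨
    rowSum t ℚ.+ lo                            ≡⟨ cong (λ y → rowSum y ℚ.+ lo) y≡t ⟨
    rowSum (fillRow a r t) ℚ.+ lo              ≡⟨ fill-conserves (ℕtoℚ a) r t ⟩
    rowSum r ℚ.+ ℕtoℚ a                        ≡⟨ ℚP.+-identityʳ _ ⟨
    rowSum r ℚ.+ ℕtoℚ a ℚ.+ 0ℚ                 ∎)
  lo≤0 : lo ℚ.≤ 0ℚ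
  lo≤0 = subst (lo ℚ.≤_) B+lo≡0
           (subst (ℚ._≤ ℕtoℚ b ℚ.+ lo) (ℚP.+-identityˡ lo) (ℚP.+-monoˡ-≤ lo (0≤ℕtoℚ b)))

split-step : ∀ {n} a b {r t : Row n} → Step (a ℕ.+ b) r t →
             Step a r (fillRow a r t) × Step b (fillRow a r t) t
split-step a b {r} {t} st@(r≺t , Σt) = (r≺y , Σy) , (y≺t , Σt')
  where
  open ≡-Reasoning
  y = fillRow a r t
  bounds = fill-bounds {a = ℕtoℚ a} (≺⇒≤ᵣ r≺t) (0≤ℕtoℚ a)
  sandwiched = ≺-sandwich r≺t (proj₁ bounds) (proj₁ (proj₂ bounds))
  r≺y = proj₁ sandwiched
  y≺t = proj₂ sandwiched
  Σy : rowSum y ≡ rowSum r ℚ.+ ℕtoℚ a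
  Σy = begin
    rowSum y                                    ≡⟨ ℚP.+-identityʳ _ ⟨
    rowSum y ℚ.+ 0ℚ                             ≡⟨ cong (rowSum y ℚ.+_) (fill-exhausts a b st) ⟨
    rowSum y ℚ.+ proj₂ (fill (ℕtoℚ a) r t)      ≡⟨ fill-conserves (ℕtoℚ a) r t ⟩
    rowSum r ℚ.+ ℕtoℚ a                         ∎
  Σt' : rowSum t ≡ rowSum y ℚ.+ ℕtoℚ b
  Σt' = begin
    rowSum t                                    ≡⟨ Σt ⟩
    rowSum r ℚ.+ ℕtoℚ (a ℕ.+ b)                 ≡⟨ cong (rowSum r ℚ.+_) (ℕtoℚ-homo-+ a b) ⟩
    rowSum r ℚ.+ (ℕtoℚ a ℚ.+ ℕtoℚ b)            ≡⟨ ℚP.+-assoc (rowSum r) _ _ ⟨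
    rowSum r ℚ.+ ℕtoℚ a ℚ.+ ℕtoℚ b              ≡⟨ cong (ℚ._+ ℕtoℚ b) Σy ⟨
    rowSum y ℚ.+ ℕtoℚ b                         ∎

merge-step : ∀ {n c} a b {r y t : Row n} → Spliced c r y t → Step a r y → Step b y t → Step (a ℕ.+ b) r t
merge-step a b {r} {y} {t} sp (r≺y , Σy) (y≺t , Σt) = ≺-merge sp r≺y y≺t , (begin
  rowSum t                              ≡⟨ Σt ⟩
  rowSum y ℚ.+ ℕtoℚ b                   ≡⟨ cong (ℚ._+ ℕtoℚ b) Σy ⟩
  rowSum r ℚ.+ ℕtoℚ a ℚ.+ ℕtoℚ b        ≡⟨ ℚP.+-assoc (rowSum r) _ _ ⟩
  rowSum r ℚ.+ (ℕtoℚ a ℚ.+ ℕtoℚ b)      ≡⟨ cong (rowSum r ℚ.+_) (ℕtoℚ-homo-+ a b) ⟨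
  rowSum r ℚ.+ ℕtoℚ (a ℕ.+ b)           ∎)
  where open ≡-Reasoning

Chain : ∀ {n} (w : List ℕ) → Vec (Row n) (suc (length w)) → Set
Chain []      _       = ⊤
Chain (a ∷ w) (r ∷ x) = Step a r (lookup x F.zero) × Chain w x

lookup-≤⇒≺ : ∀ {n} {r s : Row n} → (∀ j → lookup r j ℚ.≤ lookup s j) →
             (∀ (j k : Fin n) → toℕ k ≡ suc (toℕ j) → lookup s k ℚ.≤ lookup r j) → r ≺ s
lookup-≤⇒≺ {r = []}     {[]}         _  _  = []
lookup-≤⇒≺ {r = _ ∷ []} {_ ∷ []}     le _  = interlace (le F.zero) tt []
lookup-≤⇒≺ {r = _ ∷ _ ∷ _} {_ ∷ _ ∷ _} le ge =
  interlace (le F.zero) (ge F.zero (F.suc F.zero) refl)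
            (lookup-≤⇒≺ (λ j → le (F.suc j)) (λ j k e → ge (F.suc j) (F.suc k) (cong suc e)))

≺⇒lookup-≤ : ∀ {n} {r s : Row n} → r ≺ s → ∀ j → lookup r j ℚ.≤ lookup s j
≺⇒lookup-≤ r≺s = Pointwise.lookup (≺⇒≤ᵣ r≺s)

≺⇒lookup-≥ : ∀ {n} {r s : Row n} → r ≺ s →
             ∀ (j k : Fin n) → toℕ k ≡ suc (toℕ j) → lookup s k ℚ.≤ lookup r j
≺⇒lookup-≥ {s = _ ∷ _ ∷ _} (interlace _ hd _) F.zero (F.suc F.zero) refl = hd
≺⇒lookup-≥ (interlace _ _ rs≺ss) (F.suc j) (F.suc k) e = ≺⇒lookup-≥ rs≺ss j k (ℕP.suc-injective e)

p-q≡a⇒p≡q+a : ∀ {p q a} → p ℚ.- q ≡ a → p ≡ q ℚ.+ a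
p-q≡a⇒p≡q+a {p} {q} refl = solve 2 (λ p q → p := q :+ (p :- q)) refl p q

p≡q+a⇒p-q≡a : ∀ {p q a} → p ≡ q ℚ.+ a → p ℚ.- q ≡ a
p≡q+a⇒p-q≡a {q = q} {a} refl = solve 2 (λ q a → (q :+ a) :- q := a) refl q a

module _ {n : ℕ} (w : List ℕ) where

  LowerInterlacing UpperInterlacing RowSums : Pat (suc (length w)) n → Set
  LowerInterlacing x = ∀ (i : Fin (length w)) (j : Fin n) → entry x (inject₁ i) j ℚ.≤ entry x (F.suc i) j
  UpperInterlacing x = ∀ (i : Fin (length w)) (j k : Fin n) → toℕ k ≡ suc (toℕ j) →
                       entry x (F.suc i) k ℚ.≤ entry x (inject₁ i) j
  RowSums x = ∀ (i : Fin (length w)) →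
              rowSum (lookup x (F.suc i)) ℚ.- rowSum (lookup x (inject₁ i)) ≡ ℕtoℚ (L.lookup w i)

conditions⇒Chain : ∀ {n} w {x : Pat (suc (length w)) n} →
                   LowerInterlacing w x → UpperInterlacing w x → RowSums w x → Chain w x
conditions⇒Chain []      _ _ _ = tt
conditions⇒Chain (a ∷ w) {_ ∷ _ ∷ _} lower upper sums =
  (lookup-≤⇒≺ (lower F.zero) (upper F.zero) , p-q≡a⇒p≡q+a (sums F.zero)) ,
  conditions⇒Chain w (λ i → lower (F.suc i)) (λ i → upper (F.suc i)) (λ i → sums (F.suc i))

Chain⇒lower : ∀ {n} w {x : Pat (suc (length w)) n} → Chain w x → LowerInterlacing w x
Chain⇒lower (a ∷ w) {_ ∷ _ ∷ _} ((r≺s , _) , _)  F.zero    = ≺⇒lookup-≤ r≺s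
Chain⇒lower (a ∷ w) {_ ∷ _ ∷ _} (_ , ch)         (F.suc i) = Chain⇒lower w ch i

Chain⇒upper : ∀ {n} w {x : Pat (suc (length w)) n} → Chain w x → UpperInterlacing w x
Chain⇒upper (a ∷ w) {_ ∷ _ ∷ _} ((r≺s , _) , _)  F.zero    = ≺⇒lookup-≥ r≺s
Chain⇒upper (a ∷ w) {_ ∷ _ ∷ _} (_ , ch)         (F.suc i) = Chain⇒upper w ch i

Chain⇒sums : ∀ {n} w {x : Pat (suc (length w)) n} → Chain w x → RowSums w x
Chain⇒sums (a ∷ w) {_ ∷ _ ∷ _} ((_ , Σs) , _)  F.zero    = p≡q+a⇒p-q≡a Σs
Chain⇒sums (a ∷ w) {_ ∷ _ ∷ _} (_ , ch)        (F.suc i) = Chain⇒sums w ch i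

GT⇒Chain : ∀ {n} {la mu : Vec ℕ n} w {x} → GT la mu w x → Chain w x
GT⇒Chain w (lower , upper , _ , _ , sums) = conditions⇒Chain w lower upper sums

Chain⇒GT : ∀ {n} {la mu : Vec ℕ n} w {x : Pat (suc (length w)) n} → Chain w x →
           lookup x (fromℕ (length w)) ≡ V.map ℕtoℚ la → lookup x F.zero ≡ V.map ℕtoℚ mu → GT la mu w x
Chain⇒GT w ch top bottom = Chain⇒lower w ch , Chain⇒upper w ch , top , bottom , Chain⇒sums w ch

module Position (a b : ℕ) (post : List ℕ) where

  Coarse Fine : List ℕ → List ℕ
  Coarse pre = pre ++ a ℕ.+ b ∷ post
  Fine   pre = pre ++ a ∷ b ∷ post

  private variable
    B C : Set

  insert : (B → B → B) → ∀ pre → Vec B (suc (length (Coarse pre))) → Vec B (suc (length (Fine pre)))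
  insert f []        (r ∷ t ∷ x) = r ∷ f r t ∷ t ∷ x
  insert f (_ ∷ pre) (r ∷ x)     = r ∷ insert f pre x

  delete : ∀ pre → Vec B (suc (length (Fine pre))) → Vec B (suc (length (Coarse pre)))
  delete []        (r ∷ _ ∷ x) = r ∷ x
  delete (_ ∷ pre) (r ∷ x)     = r ∷ delete pre x

  At : ∀ pre → (B → B → B → Set) → Vec B (suc (length (Fine pre))) → Set
  At []        R (r ∷ y ∷ t ∷ _) = R r y t
  At (_ ∷ pre) R (_ ∷ x)         = At pre R x

  delete-insert : ∀ (f : B → B → B) pre x → delete pre (insert f pre x) ≡ x
  delete-insert f []        (r ∷ t ∷ x) = refl
  delete-insert f (_ ∷ pre) (r ∷ x)     = cong (r ∷_) (delete-insert f pre x)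

  delete-map : ∀ (h : B → C) pre x → delete pre (V.map h x) ≡ V.map h (delete pre x)
  delete-map h []        (r ∷ _ ∷ x) = refl
  delete-map h (_ ∷ pre) (r ∷ x)     = cong (h r ∷_) (delete-map h pre x)

  delete-zipWith : ∀ (h : B → B → B) pre x y →
                   delete pre (V.zipWith h x y) ≡ V.zipWith h (delete pre x) (delete pre y)
  delete-zipWith h []        (r ∷ _ ∷ x) (s ∷ _ ∷ y) = refl
  delete-zipWith h (_ ∷ pre) (r ∷ x)     (s ∷ y)     = cong (h r s ∷_) (delete-zipWith h pre x y)

  delete-replicate : ∀ pre (e : B) → delete pre (V.replicate _ e) ≡ V.replicate _ e
  delete-replicate []        e = refl
  delete-replicate (_ ∷ pre) e = cong (e ∷_) (delete-replicate pre e)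

  insert-map : ∀ {f : B → B → B} {g : C → C → C} (h : B → C) → (∀ r t → g (h r) (h t) ≡ h (f r t)) →
               ∀ pre x → insert g pre (V.map h x) ≡ V.map h (insert f pre x)
  insert-map h hom []        (r ∷ t ∷ x) = cong (λ y → h r ∷ y ∷ h t ∷ V.map h x) (hom r t)
  insert-map h hom (_ ∷ pre) (r ∷ x)     = cong (h r ∷_) (insert-map h hom pre x)

  insert-first : ∀ (f : B → B → B) pre x → lookup (insert f pre x) F.zero ≡ lookup x F.zero
  insert-first f []        (_ ∷ _ ∷ _) = refl
  insert-first f (_ ∷ pre) (_ ∷ _)     = refl

  delete-first : ∀ pre (x : Vec B _) → lookup (delete pre x) F.zero ≡ lookup x F.zero
  delete-first []        (_ ∷ _ ∷ _) = refl
  delete-first (_ ∷ pre) (_ ∷ _)     = refl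

  insert-last : ∀ (f : B → B → B) pre x →
                lookup (insert f pre x) (fromℕ (length (Fine pre))) ≡ lookup x (fromℕ (length (Coarse pre)))
  insert-last f []        (_ ∷ _ ∷ _) = refl
  insert-last f (_ ∷ pre) (_ ∷ x)     = insert-last f pre x

  delete-last : ∀ pre (x : Vec B _) →
                lookup (delete pre x) (fromℕ (length (Coarse pre))) ≡ lookup x (fromℕ (length (Fine pre)))
  delete-last []        (_ ∷ _ ∷ _) = refl
  delete-last (_ ∷ pre) (_ ∷ x)     = delete-last pre x

  private variable
    R S : B → B → B → Set

  At-mono : (∀ {r y t} → R r y t → S r y t) → ∀ pre {x} → At pre R x → At pre S x
  At-mono R⇒S []        {_ ∷ _ ∷ _ ∷ _} at = R⇒S at
  At-mono R⇒S (_ ∷ pre) {_ ∷ _}         at = At-mono R⇒S pre at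

  At-× : ∀ pre {x} → At pre R x → At pre S x → At pre (λ r y t → R r y t × S r y t) x
  At-× []        {_ ∷ _ ∷ _ ∷ _} at at' = at , at'
  At-× (_ ∷ pre) {_ ∷ _}         at at' = At-× pre at at'

  At-∃ : ∀ {R : ℕ → B → B → B → Set} pre {x} →
         At pre (λ r y t → ∃[ c ] R c r y t) x → ∃[ c ] At pre (R c) x
  At-∃ []        {_ ∷ _ ∷ _ ∷ _} at = at
  At-∃ (_ ∷ pre) {_ ∷ _}         at = At-∃ pre at

  At-map : {S : C → C → C → Set} (h : B → C) → (∀ {r y t} → R r y t → S (h r) (h y) (h t)) →
           ∀ pre {x} → At pre R x → At pre S (V.map h x)
  At-map h R⇒S []        {_ ∷ _ ∷ _ ∷ _} at = R⇒S at
  At-map h R⇒S (_ ∷ pre) {_ ∷ _}         at = At-map h R⇒S pre at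

  At-map⁻ : {S : C → C → C → Set} (h : B → C) → (∀ {r y t} → S (h r) (h y) (h t) → R r y t) →
            ∀ pre {x} → At pre S (V.map h x) → At pre R x
  At-map⁻ h S⇒R []        {_ ∷ _ ∷ _ ∷ _} at = S⇒R at
  At-map⁻ h S⇒R (_ ∷ pre) {_ ∷ _}         at = At-map⁻ h S⇒R pre at

  At-zipWith : ∀ (h : B → B → B) →
               (∀ {r y t r' y' t'} → R r y t → R r' y' t' → R (h r r') (h y y') (h t t')) →
               ∀ pre {x x'} → At pre R x → At pre R x' → At pre R (V.zipWith h x x')
  At-zipWith h hom []        {_ ∷ _ ∷ _ ∷ _} {_ ∷ _ ∷ _ ∷ _} at at' = hom at at'
  At-zipWith h hom (_ ∷ pre) {_ ∷ _}         {_ ∷ _}         at at' = At-zipWith h hom pre at at'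

  At-zipWith⁻ : ∀ (h : B → B → B) →
                (∀ {r y t r' y' t'} → R r y t → R r' y' t' →
                   S (h r r') (h y y') (h t t') → S r y t × S r' y' t') →
                ∀ pre {x x'} → At pre R x → At pre R x' →
                At pre S (V.zipWith h x x') → At pre S x × At pre S x'
  At-zipWith⁻ h split []        {_ ∷ _ ∷ _ ∷ _} {_ ∷ _ ∷ _ ∷ _} at at' s = split at at' s
  At-zipWith⁻ h split (_ ∷ pre) {_ ∷ _}         {_ ∷ _}         at at' s = At-zipWith⁻ h split pre at at' s

  At-replicate : ∀ {e : B} → R e e e → ∀ pre → At pre R (V.replicate _ e)
  At-replicate Re []        = Re
  At-replicate Re (_ ∷ pre) = At-replicate Re pre

  At-unique : (∀ {r y y' t} → R r y t → R r y' t → y ≡ y') →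
              ∀ pre {x x'} → At pre R x → At pre R x' → delete pre x ≡ delete pre x' → x ≡ x'
  At-unique unique [] {r ∷ y ∷ t ∷ x} {_ ∷ _ ∷ _ ∷ _} at at' eq
    with refl , eq' ← VP.∷-injective eq with refl , refl ← VP.∷-injective eq' =
    cong (λ y → r ∷ y ∷ t ∷ x) (unique at at')
  At-unique unique (_ ∷ pre) {_ ∷ _} {_ ∷ _} at at' eq =
    cong₂ _∷_ (VP.∷-injectiveˡ eq) (At-unique unique pre at at' (VP.∷-injectiveʳ eq))

  insert-At : ∀ {n} {R : Row n → Row n → Row n → Set} {f : Row n → Row n → Row n} →
              (∀ {r t} → Step (a ℕ.+ b) r t → R r (f r t) t) →
              ∀ pre {x} → Chain (Coarse pre) x → At pre R (insert f pre x)
  insert-At split []        {_ ∷ _ ∷ _} (st , _)  = split st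
  insert-At split (_ ∷ pre) {_ ∷ _}     (_ , ch)  = insert-At split pre ch

  Chain-insert : ∀ {n} {f : Row n → Row n → Row n} →
                 (∀ {r t} → Step (a ℕ.+ b) r t → Step a r (f r t) × Step b (f r t) t) →
                 ∀ pre {x} → Chain (Coarse pre) x → Chain (Fine pre) (insert f pre x)
  Chain-insert split []        {_ ∷ _ ∷ _} (st , ch) = proj₁ (split st) , proj₂ (split st) , ch
  Chain-insert split (p ∷ pre) {r ∷ x}     (st , ch) =
    subst (Step p r) (sym (insert-first _ pre x)) st , Chain-insert split pre ch

  Chain-delete : ∀ {n} {R : Row n → Row n → Row n → Set} →
                 (∀ {r y t} → R r y t → Step a r y → Step b y t → Step (a ℕ.+ b) r t) →
                 ∀ pre {x} → At pre R x → Chain (Fine pre) x → Chain (Coarse pre) (delete pre x)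
  Chain-delete merge []        {_ ∷ _ ∷ _ ∷ _} at (st₁ , st₂ , ch) = merge at st₁ st₂ , ch
  Chain-delete merge (p ∷ pre) {r ∷ x}         at (st , ch)        =
    subst (Step p r) (sym (delete-first pre x)) st , Chain-delete merge pre at ch

  Chain⇒At : ∀ {n} pre {x : Vec (Row n) _} → Chain (Fine pre) x → At pre (λ r y t → Step a r y × Step b y t) x
  Chain⇒At []        {_ ∷ _ ∷ _ ∷ _} (st₁ , st₂ , _) = st₁ , st₂
  Chain⇒At (_ ∷ pre) {_ ∷ _}         (_ , ch)        = Chain⇒At pre ch

fillRowℤ : ∀ {n} → ℕ → Vec ℤ n → Vec ℤ n → Vec ℤ n
fillRowℤ a r t = proj₁ (ℤFill.fill (+ a) r t)

ι-fillRow : ∀ {n} a (r t : Vec ℤ n) → fillRow a (V.map ι r) (V.map ι t) ≡ V.map ι (fillRowℤ a r t)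
ι-fillRow a r t = cong proj₁ (ι-fill (+ a) r t)

fillRow-* : ∀ {n} k a (r t : Row n) →
            fillRow (k ℕ.* a) (ℕtoℚ k *ᵣ r) (ℕtoℚ k *ᵣ t) ≡ ℕtoℚ k *ᵣ fillRow a r t
fillRow-* k a r t = trans (cong (λ c → proj₁ (fill c (ℕtoℚ k *ᵣ r) (ℕtoℚ k *ᵣ t))) (ℕtoℚ-homo-* k a))
                          (cong proj₁ (*-fill (ℕtoℚ k) (0≤ℕtoℚ k) (ℕtoℚ a) r t))

toPat-zipWith : ∀ {m n} (u v : ZPat m n) → toPat (V.zipWith (V.zipWith ℤ._+_) u v) ≡ toPat u ⊕ toPat v
toPat-zipWith []      []      = refl
toPat-zipWith (r ∷ u) (s ∷ v) = cong₂ _∷_ (row r s) (toPat-zipWith u v)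
  where
  row : ∀ {n} (r s : Vec ℤ n) → V.map ι (V.zipWith ℤ._+_ r s) ≡ V.map ι r +ᵣ V.map ι s
  row []      []      = refl
  row (p ∷ r) (q ∷ s) = cong₂ _∷_ (ι-homo-+ p q) (row r s)

Dominated : ∀ {m m' n} → Region m n → Region m' n → Set
Dominated P Q = LatticeCardLeq P Q × (IsEmpty Q → IsEmpty P)
              × (Integral Q → Integral P) × (HasIDP Q → HasIDP P)

Dominated-refl : ∀ {m n} {P : Region m n} → Dominated P P
Dominated-refl = ((λ z → z) , (λ _ pz → pz) , (λ _ _ _ _ eq → eq)) , (λ e → e) , (λ i → i) , (λ d → d)

Dominated-trans : ∀ {m m' m'' n} {P : Region m n} {Q : Region m' n} {R : Region m'' n} →
                  Dominated P Q → Dominated Q R → Dominated P R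
Dominated-trans ((f , f∈ , f-inj) , e₁ , i₁ , d₁) ((g , g∈ , g-inj) , e₂ , i₂ , d₂) =
  ((λ z → g (f z)) , (λ z pz → g∈ (f z) (f∈ z pz)) ,
   (λ z z' pz pz' eq → f-inj z z' pz pz' (g-inj (f z) (f z') (f∈ z pz) (f∈ z' pz') eq))) ,
  (λ e → e₁ (e₂ e)) , (λ i → i₁ (i₂ i)) , (λ d → d₁ (d₂ d))

module SplitDominance (a b : ℕ) (post : List ℕ) {n} (la mu : Vec ℕ n) (pre : List ℕ) where
  open Position a b post

  P : Region (suc (length (Coarse pre))) n
  P = GT la mu (Coarse pre)

  P′ : Region (suc (length (Fine pre))) n
  P′ = GT la mu (Fine pre)

  lift : Pat (suc (length (Coarse pre))) n → Pat (suc (length (Fine pre))) n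
  lift = insert (fillRow a) pre

  OnFace : ℕ → Pat (suc (length (Fine pre))) n → Set
  OnFace c = At pre (Spliced c)

  InBox : Pat (suc (length (Fine pre))) n → Set
  InBox = At pre (λ r y t → r ≤ᵣ y × y ≤ᵣ t)

  lift-∈ : ∀ {x} → P x → P′ (lift x)
  lift-∈ {x} px@(_ , _ , top , bottom , _) =
    Chain⇒GT (Fine pre) (Chain-insert (split-step a b) pre (GT⇒Chain (Coarse pre) px))
      (trans (insert-last _ pre x) top) (trans (insert-first _ pre x) bottom)

  lift-OnFace : ∀ {x} → P x → ∃[ c ] OnFace c (lift x)
  lift-OnFace px =
    At-∃ pre (insert-At (λ st → fill-spliced (≺⇒≤ᵣ (proj₁ st))) pre (GT⇒Chain (Coarse pre) px))

  delete-lift : ∀ x → delete pre (lift x) ≡ x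
  delete-lift = delete-insert _ pre

  delete-∈ : ∀ {c p} → P′ p → OnFace c p → P (delete pre p)
  delete-∈ {p = p} p∈P′@(_ , _ , top , bottom , _) face =
    Chain⇒GT (Coarse pre) (Chain-delete (merge-step a b) pre face (GT⇒Chain (Fine pre) p∈P′))
      (trans (delete-last pre p) top) (trans (delete-first pre p) bottom)

  P′⇒Steps : ∀ {p} → P′ p → At pre (λ r y t → Step a r y × Step b y t) p
  P′⇒Steps p∈P′ = Chain⇒At pre (GT⇒Chain (Fine pre) p∈P′)

  P′⇒InBox : ∀ {p} → P′ p → InBox p
  P′⇒InBox p∈P′ = At-mono (λ ((r≺y , _) , (y≺t , _)) → ≺⇒≤ᵣ r≺y , ≺⇒≤ᵣ y≺t) pre (P′⇒Steps p∈P′)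

  delete-injective-OnFace : ∀ {c p q} → P′ p → P′ q → OnFace c p → OnFace c q →
                            delete pre p ≡ delete pre q → p ≡ q
  delete-injective-OnFace p∈P′ q∈P′ fp fq =
    At-unique (λ (sp , (_ , Σy) , _) (sp' , (_ , Σy') , _) → Spliced-unique sp sp' (trans Σy (sym Σy')))
      pre      (At-× pre fp (P′⇒Steps p∈P′)) (At-× pre fq (P′⇒Steps q∈P′))

  OnFace-⊕⁻ : ∀ {c p q} → InBox p → InBox q → OnFace c (p ⊕ q) → OnFace c p × OnFace c q
  OnFace-⊕⁻ = At-zipWith⁻ _+ᵣ_ (λ (r≤y , y≤t) (r'≤y' , y'≤t') → Spliced-+ᵣ⁻ r≤y y≤t r'≤y' y'≤t') pre

  OnFace-•⁻ : ∀ {c s p} → 0ℚ ℚ.< s → OnFace c (s • p) → OnFace c p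
  OnFace-•⁻ {s = s} 0<s = At-map⁻ (s *ᵣ_) (Spliced-*ᵣ⁻ 0<s) pre

  OnFace-• : ∀ {c} s {p} → OnFace c p → OnFace c (s • p)
  OnFace-• s = At-map (s *ᵣ_) (Spliced-map (s ℚ.*_)) pre

  InBox-⊕ : ∀ {p q} → InBox p → InBox q → InBox (p ⊕ q)
  InBox-⊕ = At-zipWith _+ᵣ_
    (λ (r≤y , y≤t) (r'≤y' , y'≤t') → +ᵣ-mono-≤ᵣ r≤y r'≤y' , +ᵣ-mono-≤ᵣ y≤t y'≤t') pre

  InBox-• : ∀ {s p} → 0ℚ ℚ.≤ s → InBox p → InBox (s • p)
  InBox-• {s} 0≤s = At-map (s *ᵣ_) (λ (r≤y , y≤t) → *ᵣ-mono-≤ᵣ 0≤s r≤y , *ᵣ-mono-≤ᵣ 0≤s y≤t) pre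

  toPat-insert : ∀ c (z : ZPat _ n) →
                 toPat (insert (fillRowℤ c) pre z) ≡ insert (fillRow c) pre (toPat z)
  toPat-insert c z = sym (insert-map (V.map ι) (ι-fillRow c) pre z)

  lift-LatticeCardLeq : LatticeCardLeq P P′
  lift-LatticeCardLeq =
    insert (fillRowℤ a) pre ,
    (λ z pz → subst P′ (sym (toPat-insert a z)) (lift-∈ pz)) ,
    (λ z z' _ _ eq → trans (sym (delete-insert _ pre z))
                           (trans (cong (delete pre) eq) (delete-insert _ pre z')))

  IsEmpty-transfer : IsEmpty P′ → IsEmpty P
  IsEmpty-transfer emptyP′ x px = emptyP′ (lift x) (lift-∈ px)

  lift-IsVertex : ∀ {x} → IsVertex P x → IsVertex P′ (lift x)
  lift-IsVertex {x} (px , extreme) = lift-∈ px , extreme-lift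
    where
    c = proj₁ (lift-OnFace px)

    extreme-lift : ∀ p q s → P′ p → P′ q → 0ℚ ℚ.< s → s ℚ.< 1ℚ →
                   lift x ≡ (s • p) ⊕ ((1ℚ ℚ.- s) • q) → p ≡ q
    extreme-lift p q s p∈P′ q∈P′ 0<s s<1 lift≡ =
      delete-injective-OnFace p∈P′ q∈P′ fp fq (extreme _ _ s (delete-∈ p∈P′ fp) (delete-∈ q∈P′ fq) 0<s s<1 x≡)
      where
      open ≡-Reasoning
      s' = 1ℚ ℚ.- s
      0<s' = p<q⇒0<q-p s<1
      faces = OnFace-⊕⁻ (InBox-• (ℚP.<⇒≤ 0<s) (P′⇒InBox p∈P′)) (InBox-• (ℚP.<⇒≤ 0<s') (P′⇒InBox q∈P′))
                        (subst (OnFace c) lift≡ (proj₂ (lift-OnFace px)))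
      fp = OnFace-•⁻ 0<s (proj₁ faces)
      fq = OnFace-•⁻ 0<s' (proj₂ faces)
      x≡ : x ≡ (s • delete pre p) ⊕ (s' • delete pre q)
      x≡ = begin
        x                                         ≡⟨ delete-lift x ⟨
        delete pre (lift x)                       ≡⟨ cong (delete pre) lift≡ ⟩
        delete pre ((s • p) ⊕ (s' • q))           ≡⟨ delete-zipWith _+ᵣ_ pre (s • p) (s' • q) ⟩
        delete pre (s • p) ⊕ delete pre (s' • q)  ≡⟨ cong₂ _⊕_ (delete-map (s *ᵣ_) pre p)
                                                               (delete-map (s' *ᵣ_) pre q) ⟩
        (s • delete pre p) ⊕ (s' • delete pre q)  ∎

  Integral-transfer : Integral P′ → Integral P
  Integral-transfer integralP′ x vx =
    let z , lift≡z = integralP′ (lift x) (lift-IsVertex vx)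
    in delete pre z , (begin
      x                      ≡⟨ delete-lift x ⟨
      delete pre (lift x)    ≡⟨ cong (delete pre) lift≡z ⟩
      delete pre (toPat z)   ≡⟨ delete-map (V.map ι) pre z ⟩
      toPat (delete pre z)   ∎)
    where open ≡-Reasoning

  InBox-zsum : ∀ {k} {us : Vec (ZPat _ n) k} → VAll.All (InBox ∘ toPat) us → InBox (toPat (zsum us))
  InBox-zsum {us = []} [] =
    subst InBox (sym (VP.map-replicate (V.map ι) _ _)) (At-replicate (≤ᵣ-refl , ≤ᵣ-refl) pre)
  InBox-zsum {us = u ∷ us} (bu ∷ bus) =
    subst InBox (sym (toPat-zipWith u (zsum us))) (InBox-⊕ bu (InBox-zsum bus))

  OnFace-zsum⁻ : ∀ {c k} {us : Vec (ZPat _ n) k} → VAll.All (InBox ∘ toPat) us →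
                 OnFace c (toPat (zsum us)) → VAll.All (OnFace c ∘ toPat) us
  OnFace-zsum⁻ {us = []}     []         _    = []
  OnFace-zsum⁻ {us = u ∷ us} (bu ∷ bus) face =
    let fu , fus = OnFace-⊕⁻ bu (InBox-zsum bus) (subst (OnFace _) (toPat-zipWith u (zsum us)) face)
    in fu ∷ OnFace-zsum⁻ bus fus

  delete-zsum : ∀ {k} (us : Vec (ZPat _ n) k) → zsum (V.map (delete pre) us) ≡ delete pre (zsum us)
  delete-zsum []       = sym (delete-replicate pre _)
  delete-zsum (u ∷ us) = trans (cong (V.zipWith (V.zipWith ℤ._+_) (delete pre u)) (delete-zsum us))
                               (sym (delete-zipWith _ pre u (zsum us)))

  toPat-insert-dilate : ∀ k {z y} → toPat z ≡ ℕtoℚ k • y →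
                        toPat (insert (fillRowℤ (k ℕ.* a)) pre z) ≡ ℕtoℚ k • lift y
  toPat-insert-dilate k {z} {y} z≡ky = begin
    toPat (insert (fillRowℤ (k ℕ.* a)) pre z)       ≡⟨ toPat-insert (k ℕ.* a) z ⟩
    insert (fillRow (k ℕ.* a)) pre (toPat z)        ≡⟨ cong (insert (fillRow (k ℕ.* a)) pre) z≡ky ⟩
    insert (fillRow (k ℕ.* a)) pre (ℕtoℚ k • y)     ≡⟨ insert-map (ℕtoℚ k *ᵣ_) (fillRow-* k a) pre y ⟩
    ℕtoℚ k • lift y                                 ∎
    where open ≡-Reasoning

  HasIDP-transfer : HasIDP P′ → HasIDP P
  HasIDP-transfer (integralP′ , decomposeP′) = Integral-transfer integralP′ , decompose
    where
    decompose : ∀ k → 1 ℕ.≤ k → ∀ z → Dilate k P (toPat z) →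
                ∃ λ (zs : Vec (ZPat _ n) k) → VAll.All (P ∘ toPat) zs × (zsum zs ≡ z)
    decompose k 1≤k z (y , py , z≡ky) = V.map (delete pre) zs , AllP.map⁺ deleted∈P , zsum≡z
      where
      z' = insert (fillRowℤ (k ℕ.* a)) pre z
      z'≡ky' = toPat-insert-dilate k z≡ky
      decomposition = decomposeP′ k 1≤k z' (lift y , lift-∈ py , z'≡ky')
      zs = proj₁ decomposition
      zs∈P′ = proj₁ (proj₂ decomposition)
      zsum≡z' = proj₂ (proj₂ decomposition)
      c = proj₁ (lift-OnFace py)
      zs-OnFace : VAll.All (OnFace c ∘ toPat) zs
      zs-OnFace = OnFace-zsum⁻ (VAll.map P′⇒InBox zs∈P′)
        (subst (OnFace c) (sym (trans (cong toPat zsum≡z') z'≡ky'))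
               (OnFace-• (ℕtoℚ k) (proj₂ (lift-OnFace py))))
      deleted∈P : VAll.All (P ∘ toPat ∘ delete pre) zs
      deleted∈P = VAll.map (λ (u∈P′ , fu) → subst P (delete-map (V.map ι) pre _) (delete-∈ u∈P′ fu))
                           (VAll.zip (zs∈P′ , zs-OnFace))
      zsum≡z = trans (delete-zsum zs) (trans (cong (delete pre) zsum≡z') (delete-insert _ pre z))

  split-Dominated : Dominated P P′
  split-Dominated = lift-LatticeCardLeq , IsEmpty-transfer , Integral-transfer , HasIDP-transfer

data Split : List ℕ → List ℕ → Set where
  split : ∀ pre a b post → Split (pre ++ a ℕ.+ b ∷ post) (pre ++ a ∷ b ∷ post)

Split-cons : ∀ p {w w'} → Split w w' → Split (p ∷ w) (p ∷ w')
Split-cons p (split pre a b post) = split (p ∷ pre) a b post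

Splits-block : ∀ x xs rest → Star Split (sum (x ∷ xs) ∷ rest) ((x ∷ xs) ++ rest)
Splits-block x []       rest = subst (λ s → Star Split (s ∷ rest) (x ∷ rest)) (sym (ℕP.+-identityʳ x)) ε
Splits-block x (y ∷ ys) rest =
  split [] x (sum (y ∷ ys)) rest ◅ Star.gmap (x ∷_) (Split-cons x) (Splits-block y ys rest)

Splits-blocks : ∀ bs → LAll.All (_≢ []) bs → Star Split (L.map sum bs) (L.concat bs)
Splits-blocks []              LAll.[]               = ε
Splits-blocks ([] ∷ _)        (ne LAll.∷ _)         = ⊥-elim (ne refl)
Splits-blocks ((x ∷ xs) ∷ bs) (_ LAll.∷ nonempty) =
  Star.gmap (sum (x ∷ xs) ∷_) (Split-cons _) (Splits-blocks bs nonempty)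
    ◅◅ Splits-block x xs (L.concat bs)

≤ref⇒Splits : ∀ {w w'} → w' ≤ref w → Star Split w w'
≤ref⇒Splits (bs , nonempty , concat≡w' , sums≡w) =
  subst₂ (Star Split) sums≡w concat≡w' (Splits-blocks bs nonempty)

Splits-Dominated : ∀ {n} (la mu : Vec ℕ n) {w w'} → Star Split w w' →
                   Dominated (GT la mu w) (GT la mu w')
Splits-Dominated la mu = Star.fold (λ w w' → Dominated (GT la mu w) (GT la mu w'))
  (λ { (split pre a b post) → Dominated-trans (SplitDominance.split-Dominated a b post la mu pre) })
  Dominated-refl

mainTheorem3 : ∀ (n : ℕ) (la mu : Vec ℕ n) → IsPartition la → IsPartition mu →
    (∀ (j : Fin n) → lookup mu j ≤ lookup la j) →
    ∀ (w w' : List ℕ) → IsComposition w → IsComposition w' → w' <ref w →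
    LatticeCardLeq (GT la mu w) (GT la mu w')
    × (IsEmpty (GT la mu w') → IsEmpty (GT la mu w))
    × (Integral (GT la mu w') → Integral (GT la mu w))
    × (HasIDP (GT la mu w') → HasIDP (GT la mu w))
mainTheorem3 n la mu _ _ _ w w' _ _ (w'≤w , _) = Splits-Dominated la mu (≤ref⇒Splits w'≤w)
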